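{- Let $m\ge3$ be an integer and let $\mathrm{W}(m)$ be the wreath graph. If $m$ is not divisible by $4$, then every distance magic labeling of $\mathrm{W}(m)$ is self-reverse and degenerate. For each $m\ge4$ with $4\mid m$, the graph $\mathrm{W}(m)$ admits a degenerate self-reverse distance magic labeling and a non-degenerate self-reverse distance magic labeling; in addition, if $4\mid m$ and $m\ge 8$, then $\mathrm{W}(m)$ also admits a distance magic labeling that is not self-reverse.
   Context: For $m\ge3$, the wreath graph $\mathrm{W}(m)$ is the tetravalent graph of order $2m$ with vertex set $\{x_i,y_i\colon i\in\mathbb{Z}_m\}$, where for each $i\in\mathbb{Z}_m$ each of $x_i,y_i$ is adjacent to each of $x_{i-1},y_{i-1},x_{i+1},y_{i+1}$ (indices mod $m$). For a positive integer $n$, $\mathcal{I}_n=\{1-n,3-n,\ldots,n-1\}$. For a regular graph $\Gamma$ of order $n$, a distance magic labeling is a bijection $\ell\colon V(\Gamma)\to\mathcal{I}_n$ such that for every vertex the sum of the labels of its neighbors equals $0$. For $v\in V(\Gamma)$, $v^\ell$ is the unique vertex with $\ell(v)+\ell(v^\ell)=0$; $\ell$ is self-reverse if for all vertices $u,v$: $u\sim v$ if and only if $u^\ell\sim v^\ell$. A distance magic labeling $\ell$ of a tetravalent graph is degenerate if there exist vertices $u,v$ with $u\ne u^\ell$, $v\ne v^\ell$ such that $u$ is adjacent to both $v$ and $v^\ell$; otherwise it is non-degenerate. -}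

module Defs where

open import Data.Bool using (Bool; true; false; if_then_else_)
open import Data.Nat as ℕ using (ℕ; zero; suc; _<_)
open import Data.Fin using (Fin; toℕ)
open import Data.List using (List; []; _∷_; map; _++_; allFin)
open import Data.Integer using (ℤ; +_; 0ℤ; _+_; _-_)
open import Data.Product using (_×_; _,_; ∃-syntax)
open import Data.Sum using (_⊎_)
open import Relation.Nullary using (¬_; Dec; does)
open import Relation.Nullary.Decidable using (_×-dec_; _⊎-dec_)
open import Relation.Binary.PropositionalEquality using (_≡_; _≢_)
open import Function using (_⇔_)
open import Function.Definitions using (Injective)

-- Vertices of W(m): (false , i) is x_i and (true , i) is y_i, i ∈ ℤ_m ≅ Fin m.
Vertex : ℕ → Set
Vertex m = Bool × Fin m

CycAdj : (m : ℕ) → Fin m → Fin m → Set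
CycAdj m i j =
  (toℕ j ≡ suc (toℕ i)) ⊎ (toℕ i ≡ suc (toℕ j))
  ⊎ ((toℕ j ≡ 0 × suc (toℕ i) ≡ m) ⊎ (toℕ i ≡ 0 × suc (toℕ j) ≡ m))

cycAdj? : (m : ℕ) → (i j : Fin m) → Dec (CycAdj m i j)
cycAdj? m i j =
  (toℕ j ℕ.≟ suc (toℕ i)) ⊎-dec (toℕ i ℕ.≟ suc (toℕ j))
  ⊎-dec (((toℕ j ℕ.≟ 0) ×-dec (suc (toℕ i) ℕ.≟ m))
         ⊎-dec ((toℕ i ℕ.≟ 0) ×-dec (suc (toℕ j) ℕ.≟ m)))

Adj : (m : ℕ) → Vertex m → Vertex m → Set
Adj m (a , i) (b , j) = CycAdj m i j

adj? : (m : ℕ) → (u v : Vertex m) → Dec (Adj m u v)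
adj? m (a , i) (b , j) = cycAdj? m i j

vertices : (m : ℕ) → List (Vertex m)
vertices m = map (λ i → (false , i)) (allFin m) ++ map (λ i → (true , i)) (allFin m)

sumℤ : List ℤ → ℤ
sumℤ [] = 0ℤ
sumℤ (z ∷ zs) = z + sumℤ zs

neighbourSum : (m : ℕ) → (Vertex m → ℤ) → Vertex m → ℤ
neighbourSum m ℓ v =
  sumℤ (map (λ w → if does (adj? m v w) then ℓ w else 0ℤ) (vertices m))

InI : ℕ → ℤ → Set
InI n z = ∃[ k ] (k < n × z ≡ (+ 1 - + n) + + (2 ℕ.* k))

IsDML : (m : ℕ) → (Vertex m → ℤ) → Set
IsDML m ℓ =
  (∀ v → InI (2 ℕ.* m) (ℓ v))
  × Injective _≡_ _≡_ ℓ
  × (∀ z → InI (2 ℕ.* m) z → ∃[ v ] ℓ v ≡ z)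
  × (∀ v → neighbourSum m ℓ v ≡ 0ℤ)

-- self-reverse: u ~ v iff u^ℓ ~ v^ℓ, where u^ℓ is the vertex with ℓ u + ℓ u^ℓ = 0
SelfReverse : (m : ℕ) → (Vertex m → ℤ) → Set
SelfReverse m ℓ =
  ∀ u u' v v' → ℓ u + ℓ u' ≡ 0ℤ → ℓ v + ℓ v' ≡ 0ℤ → (Adj m u v ⇔ Adj m u' v')

Degenerate : (m : ℕ) → (Vertex m → ℤ) → Set
Degenerate m ℓ =
  ∃[ u ] ∃[ u' ] ∃[ v ] ∃[ v' ]
    (ℓ u + ℓ u' ≡ 0ℤ × ℓ v + ℓ v' ≡ 0ℤ × u ≢ u' × v ≢ v'
     × Adj m u v × Adj m u v')

-- Let S i be the sum of the labels of x_i and y_i. The neighbours of x_i and of y_i are the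
-- columns i ± 1, so a bijective labeling is distance magic iff S (i − 1) + S (i + 1) = 0 for
-- all i, i.e. S (i + 2) = − S i. If 4 ∤ m, some multiple of m is 2 mod 4, so walking around
-- the cycle gives S i = − S i: every column sums to 0, the reverse of x_i is y_i, and as x_i
-- and y_i have the same neighbours the labeling is self-reverse and degenerate.
--
-- If 4 ∣ m, labeling x_i, y_i by ∓(2i + 1) already works. Giving column i the labels
-- σ_i (2i + 1) and σ_i (2(m − 1 − i) + 1) instead, with σ = + + − − repeated, makes S i = σ_i 2m,
-- which again satisfies the recurrence. Now the reverse of x_i is y_{m−1−i}, so the reflection
-- i ↦ m − 1 − i of the cycle shows that it is self-reverse; it is non-degenerate because the
-- two neighbours of a column have equal parity whereas i and m − 1 − i do not. Exchanging
-- columns 0 and 4 preserves all column sums, but for m ≥ 8 destroys self-reversality.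

{-# OPTIONS --safe #-}
module Submission where

open import Defs
open import Data.Bool using (Bool; true; false; not; if_then_else_)
import Data.Bool.Properties as Boolₚ
open import Data.Fin using (Fin; toℕ; fromℕ<; opposite)
open import Data.Fin.Patterns using (0F; 1F; 2F; 3F; 4F)
import Data.Fin.Properties as Finₚ
open import Data.Integer using (ℤ; +_; +[1+_]; -[1+_]; 0ℤ; _+_; _-_; -_)
import Data.Integer.Properties as ℤₚ
open import Data.Integer.Tactic.RingSolver using () renaming (solve-∀ to ℤ-solve-∀)
open import Data.List using ([]; _∷_; map; _++_; allFin; tabulate)
import Data.List.Properties as Listₚ
open import Data.Nat as ℕ using (ℕ; zero; suc; _≤_; _<_; s≤s; parity; _%_)
open import Data.Nat.DivMod
  using (_mod_; m≡m%n+[m/n]*n; %-distribˡ-+; %-remove-+ˡ; m%n%n≡m%n; m<n⇒m%n≡m; n%n≡0; m%n<n)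
open import Data.Nat.Divisibility using (_∣_; _∣?_; divides; ∣-refl; ∣⇒≤)
import Data.Nat.Properties as ℕₚ
open import Data.Nat.Tactic.RingSolver using (solve-∀)
open import Data.Parity using (0ℙ; _⁻¹)
import Data.Parity as ℙ
import Data.Parity.Properties as Parityₚ
open import Data.Product using (_×_; _,_; ∃-syntax; proj₁; proj₂; map₂)
open import Data.Sum using (_⊎_; inj₁; inj₂; [_,_])
import Data.Sum as Sum
open import Function using (_∘_; id; _⇔_; mk⇔; Equivalence)
open import Function.Definitions using (Injective; StrictlySurjective)
open import Relation.Nullary using (¬_; yes; no; does; contradiction)
open import Relation.Nullary.Decidable using (dec-true; dec-false; from-no)
open import Relation.Binary.PropositionalEquality hiding ([_])

open import Algebra.Properties.AbelianGroup ℤₚ.+-0-abelianGroup using (inverseʳ-unique)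
open import Algebra.Properties.CommutativeSemigroup ℤₚ.+-commutativeSemigroup using (interchange)

variable
  n : ℕ

retraction⇒injective : {A B : Set} {f : A → B} (g : B → A) → (∀ x → g (f x) ≡ x) → Injective _≡_ _≡_ f
retraction⇒injective g gf≡id {x} {y} fx≡fy = trans (sym (gf≡id x)) (trans (cong g fx≡fy) (gf≡id y))

x≡-x⇒x≡0 : ∀ x → x ≡ - x → x ≡ 0ℤ
x≡-x⇒x≡0 (+ zero)   _  = refl
x≡-x⇒x≡0 +[1+ _ ]  ()
x≡-x⇒x≡0 -[1+ _ ]  ()

sumℤ-++ : ∀ xs ys → sumℤ (xs ++ ys) ≡ sumℤ xs + sumℤ ys
sumℤ-++ []       ys = sym (ℤₚ.+-identityˡ _)
sumℤ-++ (x ∷ xs) ys = trans (cong (_+_ x) (sumℤ-++ xs ys)) (sym (ℤₚ.+-assoc x _ _))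

sumℤ-tabulate-zero : (G : Fin n → ℤ) → (∀ j → G j ≡ 0ℤ) → sumℤ (tabulate G) ≡ 0ℤ
sumℤ-tabulate-zero {zero}  G G≡0 = refl
sumℤ-tabulate-zero {suc n} G G≡0 =
  cong₂ _+_ (G≡0 Fin.zero) (sumℤ-tabulate-zero (G ∘ Fin.suc) (G≡0 ∘ Fin.suc))

sumℤ-tabulate-single : (G : Fin n → ℤ) (a : Fin n) → (∀ j → j ≢ a → G j ≡ 0ℤ) →
                       sumℤ (tabulate G) ≡ G a
sumℤ-tabulate-single G Fin.zero G≡0 = trans
  (cong (_+_ (G Fin.zero)) (sumℤ-tabulate-zero (G ∘ Fin.suc) (λ j → G≡0 (Fin.suc j) λ ())))
  (ℤₚ.+-identityʳ _)
sumℤ-tabulate-single G (Fin.suc a) G≡0 = trans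
  (cong₂ _+_ (G≡0 Fin.zero λ ()) (sumℤ-tabulate-single (G ∘ Fin.suc) a
    (λ j j≢a → G≡0 (Fin.suc j) (j≢a ∘ Finₚ.suc-injective))))
  (ℤₚ.+-identityˡ _)

sumℤ-tabulate-pair : (G : Fin n → ℤ) {a c : Fin n} → a ≢ c →
                     (∀ j → j ≢ a → j ≢ c → G j ≡ 0ℤ) → sumℤ (tabulate G) ≡ G a + G c
sumℤ-tabulate-pair G {Fin.zero} {Fin.zero} a≢c G≡0 = contradiction refl a≢c
sumℤ-tabulate-pair G {Fin.zero} {Fin.suc c} a≢c G≡0 = cong (_+_ (G Fin.zero))
  (sumℤ-tabulate-single (G ∘ Fin.suc) c (λ j j≢c → G≡0 (Fin.suc j) (λ ()) (j≢c ∘ Finₚ.suc-injective)))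
sumℤ-tabulate-pair G {Fin.suc a} {Fin.zero} a≢c G≡0 = trans
  (cong (_+_ (G Fin.zero))
    (sumℤ-tabulate-single (G ∘ Fin.suc) a
      (λ j j≢a → G≡0 (Fin.suc j) (j≢a ∘ Finₚ.suc-injective) (λ ()))))
  (ℤₚ.+-comm (G Fin.zero) _)
sumℤ-tabulate-pair G {Fin.suc a} {Fin.suc c} a≢c G≡0 = trans
  (cong₂ _+_ (G≡0 Fin.zero (λ ()) (λ ())) (sumℤ-tabulate-pair (G ∘ Fin.suc) (a≢c ∘ cong Fin.suc)
    (λ j j≢a j≢c → G≡0 (Fin.suc j) (j≢a ∘ Finₚ.suc-injective) (j≢c ∘ Finₚ.suc-injective))))
  (ℤₚ.+-identityˡ _)

-- The cycle on Fin m

CycSucc : (m : ℕ) → Fin m → Fin m → Set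
CycSucc m i j = (toℕ j ≡ suc (toℕ i)) ⊎ (toℕ j ≡ 0 × suc (toℕ i) ≡ m)

cycAdj⇒cycSucc : {m : ℕ} {i j : Fin m} → CycAdj m i j → CycSucc m i j ⊎ CycSucc m j i
cycAdj⇒cycSucc (inj₁ j≡1+i)               = inj₁ (inj₁ j≡1+i)
cycAdj⇒cycSucc (inj₂ (inj₁ i≡1+j))        = inj₂ (inj₁ i≡1+j)
cycAdj⇒cycSucc (inj₂ (inj₂ (inj₁ wrap)))  = inj₁ (inj₂ wrap)
cycAdj⇒cycSucc (inj₂ (inj₂ (inj₂ wrap)))  = inj₂ (inj₂ wrap)

cycSucc⇒cycAdj : {m : ℕ} {i j : Fin m} → CycSucc m i j ⊎ CycSucc m j i → CycAdj m i j
cycSucc⇒cycAdj (inj₁ (inj₁ j≡1+i)) = inj₁ j≡1+i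
cycSucc⇒cycAdj (inj₂ (inj₁ i≡1+j)) = inj₂ (inj₁ i≡1+j)
cycSucc⇒cycAdj (inj₁ (inj₂ wrap))  = inj₂ (inj₂ (inj₁ wrap))
cycSucc⇒cycAdj (inj₂ (inj₂ wrap))  = inj₂ (inj₂ (inj₂ wrap))

cycSucc-functional : {m : ℕ} {i j k : Fin m} → CycSucc m i j → CycSucc m i k → j ≡ k
cycSucc-functional (inj₁ j≡1+i) (inj₁ k≡1+i) = Finₚ.toℕ-injective (trans j≡1+i (sym k≡1+i))
cycSucc-functional {j = j} (inj₁ j≡1+i) (inj₂ (_ , 1+i≡m)) =
  contradiction (trans j≡1+i 1+i≡m) (ℕₚ.<⇒≢ (Finₚ.toℕ<n j))
cycSucc-functional {k = k} (inj₂ (_ , 1+i≡m)) (inj₁ k≡1+i) =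
  contradiction (trans k≡1+i 1+i≡m) (ℕₚ.<⇒≢ (Finₚ.toℕ<n k))
cycSucc-functional (inj₂ (j≡0 , _)) (inj₂ (k≡0 , _)) = Finₚ.toℕ-injective (trans j≡0 (sym k≡0))

toℕ-opposite-+ : {m : ℕ} (i : Fin m) → toℕ (opposite i) ℕ.+ suc (toℕ i) ≡ m
toℕ-opposite-+ i = trans (cong (ℕ._+ suc (toℕ i)) (Finₚ.opposite-prop i)) (ℕₚ.m∸n+n≡m (Finₚ.toℕ<n i))

cycSucc-opposite : {m : ℕ} {i j : Fin m} → CycSucc m i j → CycSucc m (opposite j) (opposite i)
cycSucc-opposite {m} {i} {j} (inj₁ j≡1+i) = inj₁ (ℕₚ.+-cancelʳ-≡ (suc (toℕ i)) _ _ (begin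
  toℕ (opposite i) ℕ.+ suc (toℕ i)         ≡⟨ toℕ-opposite-+ i ⟩
  m                                        ≡⟨ toℕ-opposite-+ j ⟨
  toℕ (opposite j) ℕ.+ suc (toℕ j)         ≡⟨ cong (λ x → toℕ (opposite j) ℕ.+ suc x) j≡1+i ⟩
  toℕ (opposite j) ℕ.+ suc (suc (toℕ i))   ≡⟨ ℕₚ.+-suc _ _ ⟩
  suc (toℕ (opposite j)) ℕ.+ suc (toℕ i)   ∎))
  where open ≡-Reasoning
cycSucc-opposite {m} {i} {j} (inj₂ (j≡0 , 1+i≡m)) = inj₂
  ( ℕₚ.+-cancelʳ-≡ m _ 0 (trans (cong (toℕ (opposite i) ℕ.+_) (sym 1+i≡m)) (toℕ-opposite-+ i))
  , trans (ℕₚ.+-comm 1 _) (subst (λ x → toℕ (opposite j) ℕ.+ suc x ≡ m) j≡0 (toℕ-opposite-+ j)))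

cycSucc-injective : {m : ℕ} {i j k : Fin m} → CycSucc m i k → CycSucc m j k → i ≡ j
cycSucc-injective i→k j→k = retraction⇒injective opposite Finₚ.opposite-involutive
  (cycSucc-functional (cycSucc-opposite i→k) (cycSucc-opposite j→k))

cycSucc-twoCycle : {m : ℕ} {i j : Fin m} → CycSucc m i j → CycSucc m j i → m ≤ 2
cycSucc-twoCycle {i = i} (inj₁ j≡1+i) (inj₁ i≡1+j) =
  contradiction (trans i≡1+j (cong suc j≡1+i)) (ℕₚ.m≢1+n+m (toℕ i))
cycSucc-twoCycle (inj₁ j≡1+i) (inj₂ (i≡0 , 1+j≡m)) =
  ℕₚ.≤-reflexive (trans (sym 1+j≡m) (cong suc (trans j≡1+i (cong suc i≡0))))
cycSucc-twoCycle (inj₂ (j≡0 , 1+i≡m)) (inj₁ i≡1+j) =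
  ℕₚ.≤-reflexive (trans (sym 1+i≡m) (cong suc (trans i≡1+j (cong suc j≡0))))
cycSucc-twoCycle (inj₂ (_ , 1+i≡m)) (inj₂ (i≡0 , _)) =
  ℕₚ.m≤n⇒m≤1+n (ℕₚ.≤-reflexive (trans (sym 1+i≡m) (cong suc i≡0)))

cycAdj-opposite : {m : ℕ} {i j : Fin m} → CycAdj m i j → CycAdj m (opposite i) (opposite j)
cycAdj-opposite = cycSucc⇒cycAdj ∘ Sum.swap ∘ Sum.map cycSucc-opposite cycSucc-opposite ∘ cycAdj⇒cycSucc

opposite-cycAdj : {m : ℕ} {i j : Fin m} → CycAdj m (opposite i) (opposite j) → CycAdj m i j
opposite-cycAdj {m} = subst₂ (CycAdj m) (Finₚ.opposite-involutive _) (Finₚ.opposite-involutive _)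
  ∘ cycAdj-opposite

parity-suc : ∀ k → parity (suc k) ≡ parity k ⁻¹
parity-suc k = sym (Parityₚ.⁻¹-selfInverse (Parityₚ.suc-homo-⁻¹ k))

4∣⇒even : ∀ {m} → 4 ∣ m → parity m ≡ 0ℙ
4∣⇒even (divides q refl) = trans (Parityₚ.*-homo-* q 4) (Parityₚ.*-zeroʳ (parity q))

cycSucc-parity : {m : ℕ} {i j : Fin m} → parity m ≡ 0ℙ → CycSucc m i j →
                 parity (toℕ j) ≡ parity (toℕ i) ⁻¹
cycSucc-parity {i = i} _ (inj₁ j≡1+i) = trans (cong parity j≡1+i) (parity-suc (toℕ i))
cycSucc-parity {i = i} even (inj₂ (j≡0 , 1+i≡m)) =
  trans (cong parity j≡0) (sym (trans (sym (parity-suc (toℕ i))) (trans (cong parity 1+i≡m) even)))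

cycAdj-parity : {m : ℕ} {i j : Fin m} → parity m ≡ 0ℙ → CycAdj m i j →
                parity (toℕ j) ≡ parity (toℕ i) ⁻¹
cycAdj-parity even adj with cycAdj⇒cycSucc adj
... | inj₁ i→j = cycSucc-parity even i→j
... | inj₂ j→i = sym (Parityₚ.⁻¹-selfInverse (sym (cycSucc-parity even j→i)))

opposite-parity : {m : ℕ} → parity m ≡ 0ℙ → (i : Fin m) →
                  parity (toℕ (opposite i)) ≡ parity (toℕ i) ⁻¹
opposite-parity {m} even i = Parityₚ.+-cancelʳ-≡ (p ⁻¹) _ _ (begin
  parity o ℙ.+ p ⁻¹                ≡⟨ cong (parity o ℙ.+_) (parity-suc (toℕ i)) ⟨
  parity o ℙ.+ parity (suc (toℕ i)) ≡⟨ Parityₚ.+-homo-+ o (suc (toℕ i)) ⟨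
  parity (o ℕ.+ suc (toℕ i))        ≡⟨ cong parity (toℕ-opposite-+ i) ⟩
  parity m                         ≡⟨ even ⟩
  0ℙ                               ≡⟨ Parityₚ.p+p≡0ℙ (p ⁻¹) ⟨
  p ⁻¹ ℙ.+ p ⁻¹                    ∎)
  where
  open ≡-Reasoning
  o : ℕ
  o = toℕ (opposite i)
  p : ℙ.Parity
  p = parity (toℕ i)

next : Fin (suc n) → Fin (suc n)
next {n} i = suc (toℕ i) mod suc n

-- Defined through opposite so that its properties follow from those of next.
prev : Fin (suc n) → Fin (suc n)
prev = opposite ∘ next ∘ opposite

toℕ-next : (i : Fin (suc n)) → toℕ (next i) ≡ suc (toℕ i) % suc n
toℕ-next i = Finₚ.toℕ-fromℕ< _

cycSucc-next : (i : Fin (suc n)) → CycSucc (suc n) i (next i)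
cycSucc-next {n} i with ℕₚ.m≤n⇒m<n∨m≡n (Finₚ.toℕ<n i)
... | inj₁ 1+i<m = inj₁ (trans (toℕ-next i) (m<n⇒m%n≡m 1+i<m))
... | inj₂ 1+i≡m = inj₂ (trans (toℕ-next i) (trans (cong (_% suc n) 1+i≡m) (n%n≡0 (suc n))) , 1+i≡m)

cycSucc-prev : (i : Fin (suc n)) → CycSucc (suc n) (prev i) i
cycSucc-prev {n} i = subst (CycSucc (suc n) (prev i)) (Finₚ.opposite-involutive i)
  (cycSucc-opposite (cycSucc-next (opposite i)))

prev-next : (i : Fin (suc n)) → prev (next i) ≡ i
prev-next i = cycSucc-injective (cycSucc-prev (next i)) (cycSucc-next i)

next-prev : (i : Fin (suc n)) → next (prev i) ≡ i
next-prev i = cycSucc-functional (cycSucc-next (prev i)) (cycSucc-prev i)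

cycAdj-prev : (i : Fin (suc n)) → CycAdj (suc n) i (prev i)
cycAdj-prev i = cycSucc⇒cycAdj (inj₂ (cycSucc-prev i))

cycAdj-next : (i : Fin (suc n)) → CycAdj (suc n) i (next i)
cycAdj-next i = cycSucc⇒cycAdj (inj₁ (cycSucc-next i))

cycAdj⇒prev⊎next : (i : Fin (suc n)) {j : Fin (suc n)} → CycAdj (suc n) i j → j ≡ prev i ⊎ j ≡ next i
cycAdj⇒prev⊎next i adj with cycAdj⇒cycSucc adj
... | inj₁ i→j = inj₂ (cycSucc-functional i→j (cycSucc-next i))
... | inj₂ j→i = inj₁ (cycSucc-injective j→i (cycSucc-prev i))

prev≢next : 3 ≤ suc n → (i : Fin (suc n)) → prev i ≢ next i
prev≢next {n} 3≤m i prev≡next = ℕₚ.≤⇒≯ (cycSucc-twoCycle (cycSucc-prev i)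
  (subst (CycSucc (suc n) i) (sym prev≡next) (cycSucc-next i))) 3≤m

mod-cong : ∀ k l → k % suc n ≡ l % suc n → k mod suc n ≡ l mod suc n
mod-cong _ _ eq = Finₚ.fromℕ<-cong _ _ eq _ _

toℕ-mod : (i : Fin (suc n)) → toℕ i mod suc n ≡ i
toℕ-mod i = Finₚ.toℕ-injective (trans (Finₚ.toℕ-fromℕ< _) (m<n⇒m%n≡m (Finₚ.toℕ<n i)))

suc-%-% : ∀ k → suc (k % suc n) % suc n ≡ suc k % suc n
suc-%-% {n} k = begin
  (1 ℕ.+ k % m) % m        ≡⟨ %-distribˡ-+ 1 (k % m) m ⟩
  (1 % m ℕ.+ k % m % m) % m ≡⟨ cong (λ x → (1 % m ℕ.+ x) % m) (m%n%n≡m%n k m) ⟩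
  (1 % m ℕ.+ k % m) % m     ≡⟨ %-distribˡ-+ 1 k m ⟨
  (1 ℕ.+ k) % m            ∎
  where
  open ≡-Reasoning
  m : ℕ
  m = suc n

next-mod : ∀ k → next (k mod suc n) ≡ suc k mod suc n
next-mod {n} k = mod-cong (suc (toℕ (k mod suc n))) (suc k)
  (trans (cong (λ x → suc x % suc n) (Finₚ.toℕ-fromℕ< _)) (suc-%-% {n} k))

-- Neighbour sums and column sums

sumℤ-neighbours : 3 ≤ suc n → (F : Fin (suc n) → ℤ) (i : Fin (suc n)) →
                  sumℤ (tabulate (λ j → if does (cycAdj? (suc n) i j) then F j else 0ℤ))
                    ≡ F (prev i) + F (next i)
sumℤ-neighbours {n} 3≤m F i = trans (sumℤ-tabulate-pair G (prev≢next 3≤m i) off-neighbours)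
  (cong₂ _+_ (at-neighbour (cycAdj-prev i)) (at-neighbour (cycAdj-next i)))
  where
  G : Fin (suc n) → ℤ
  G j = if does (cycAdj? (suc n) i j) then F j else 0ℤ

  at-neighbour : {j : Fin (suc n)} → CycAdj (suc n) i j → G j ≡ F j
  at-neighbour {j} adj rewrite dec-true (cycAdj? (suc n) i j) adj = refl

  off-neighbours : ∀ j → j ≢ prev i → j ≢ next i → G j ≡ 0ℤ
  off-neighbours j j≢prev j≢next
    rewrite dec-false (cycAdj? (suc n) i j) ([ j≢prev , j≢next ] ∘ cycAdj⇒prev⊎next i) = refl

columnSum : {m : ℕ} → (Vertex m → ℤ) → Fin m → ℤ
columnSum ℓ i = ℓ (false , i) + ℓ (true , i)

neighbourSum≡columnSums : 3 ≤ suc n → (ℓ : Vertex (suc n) → ℤ) (b : Bool) (i : Fin (suc n)) →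
                          neighbourSum (suc n) ℓ (b , i) ≡ columnSum ℓ (prev i) + columnSum ℓ (next i)
neighbourSum≡columnSums {n} 3≤m ℓ b i = begin
  neighbourSum (suc n) ℓ (b , i)
    ≡⟨ cong sumℤ (Listₚ.map-++ g (map (false ,_) (allFin (suc n))) (map (true ,_) (allFin (suc n)))) ⟩
  sumℤ (map g (map (false ,_) (allFin (suc n))) ++ map g (map (true ,_) (allFin (suc n))))
    ≡⟨ sumℤ-++ (map g (map (false ,_) (allFin (suc n)))) _ ⟩
  sumℤ (map g (map (false ,_) (allFin (suc n)))) + sumℤ (map g (map (true ,_) (allFin (suc n))))
    ≡⟨ cong₂ _+_ (row-sum false) (row-sum true) ⟩
  (ℓ (false , prev i) + ℓ (false , next i)) + (ℓ (true , prev i) + ℓ (true , next i))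
    ≡⟨ interchange (ℓ (false , prev i)) (ℓ (false , next i)) (ℓ (true , prev i)) (ℓ (true , next i)) ⟩
  columnSum ℓ (prev i) + columnSum ℓ (next i) ∎
  where
  open ≡-Reasoning

  g : Vertex (suc n) → ℤ
  g w = if does (adj? (suc n) (b , i) w) then ℓ w else 0ℤ

  row-sum : ∀ c → sumℤ (map g (map (c ,_) (allFin (suc n)))) ≡ ℓ (c , prev i) + ℓ (c , next i)
  row-sum c = trans
    (cong sumℤ (trans (cong (map g) (Listₚ.map-tabulate id (c ,_))) (Listₚ.map-tabulate (c ,_) g)))
    (sumℤ-neighbours 3≤m (ℓ ∘ (c ,_)) i)

Balanced : (Fin (suc n) → ℤ) → Set
Balanced s = ∀ i → s (prev i) + s (next i) ≡ 0ℤ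

isDML⇒balanced : 3 ≤ suc n → {ℓ : Vertex (suc n) → ℤ} → IsDML (suc n) ℓ → Balanced (columnSum ℓ)
isDML⇒balanced 3≤m {ℓ} (_ , _ , _ , magic) i =
  trans (sym (neighbourSum≡columnSums 3≤m ℓ false i)) (magic (false , i))

balanced⇒neighbourSum≡0 : 3 ≤ suc n → {ℓ : Vertex (suc n) → ℤ} → Balanced (columnSum ℓ) →
                          ∀ v → neighbourSum (suc n) ℓ v ≡ 0ℤ
balanced⇒neighbourSum≡0 3≤m {ℓ} balanced (b , i) =
  trans (neighbourSum≡columnSums 3≤m ℓ b i) (balanced i)

-- Column sums when 4 does not divide m

¬4∣⇒multiple≡2[mod4] : ∀ m → ¬ 4 ∣ m → ∃[ c ] ∃[ q ] c ℕ.* m ≡ 2 ℕ.+ q ℕ.* 4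
¬4∣⇒multiple≡2[mod4] m 4∤m =
  subst (λ m → ¬ 4 ∣ m → ∃[ c ] ∃[ q ] c ℕ.* m ≡ 2 ℕ.+ q ℕ.* 4) (sym (m≡m%n+[m/n]*n m 4))
    (by-residue (m % 4) (m ℕ./ 4) (m%n<n m 4)) 4∤m
  where
  by-residue : ∀ r q → r < 4 → ¬ 4 ∣ r ℕ.+ q ℕ.* 4 →
               ∃[ c ] ∃[ q′ ] c ℕ.* (r ℕ.+ q ℕ.* 4) ≡ 2 ℕ.+ q′ ℕ.* 4
  by-residue 0 q _ 4∤ = contradiction (divides q refl) 4∤
  by-residue 1 q _ _ = 2 , q ℕ.+ q , double-1 q
    where
    double-1 : ∀ q → 2 ℕ.* (1 ℕ.+ q ℕ.* 4) ≡ 2 ℕ.+ (q ℕ.+ q) ℕ.* 4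
    double-1 = solve-∀
  by-residue 2 q _ _ = 1 , q , ℕₚ.*-identityˡ _
  by-residue 3 q _ _ = 2 , suc (q ℕ.+ q) , double-3 q
    where
    double-3 : ∀ q → 2 ℕ.* (3 ℕ.+ q ℕ.* 4) ≡ 2 ℕ.+ suc (q ℕ.+ q) ℕ.* 4
    double-3 = solve-∀
  by-residue (suc (suc (suc (suc _)))) _ (s≤s (s≤s (s≤s (s≤s ())))) _

antiperiodic⇒zero : ∀ m → ¬ 4 ∣ m → (t : ℕ → ℤ) → (∀ k → t (m ℕ.+ k) ≡ t k) →
                    (∀ k → t k + t (2 ℕ.+ k) ≡ 0ℤ) → ∀ k → t k ≡ 0ℤ
antiperiodic⇒zero m 4∤m t periodic antiperiodic k with ¬4∣⇒multiple≡2[mod4] m 4∤m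
... | c , q , cm≡2+4q = x≡-x⇒x≡0 (t k) (begin
  t k                     ≡⟨ multiple-period c k ⟨
  t (c ℕ.* m ℕ.+ k)       ≡⟨ cong (λ x → t (x ℕ.+ k)) cm≡2+4q ⟩
  t (2 ℕ.+ q ℕ.* 4 ℕ.+ k) ≡⟨ flip (q ℕ.* 4 ℕ.+ k) ⟩
  - t (q ℕ.* 4 ℕ.+ k)     ≡⟨ cong -_ (four-period q k) ⟩
  - t k                   ∎)
  where
  open ≡-Reasoning

  flip : ∀ k → t (2 ℕ.+ k) ≡ - t k
  flip k = inverseʳ-unique (t k) (t (2 ℕ.+ k)) (antiperiodic k)

  four-period : ∀ q k → t (q ℕ.* 4 ℕ.+ k) ≡ t k
  four-period zero    k = refl
  four-period (suc q) k = begin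
    t (2 ℕ.+ (2 ℕ.+ (q ℕ.* 4 ℕ.+ k))) ≡⟨ flip _ ⟩
    - t (2 ℕ.+ (q ℕ.* 4 ℕ.+ k))       ≡⟨ cong -_ (flip _) ⟩
    - - t (q ℕ.* 4 ℕ.+ k)             ≡⟨ ℤₚ.neg-involutive _ ⟩
    t (q ℕ.* 4 ℕ.+ k)                 ≡⟨ four-period q k ⟩
    t k                               ∎

  multiple-period : ∀ c k → t (c ℕ.* m ℕ.+ k) ≡ t k
  multiple-period zero    k = refl
  multiple-period (suc c) k =
    trans (cong t (ℕₚ.+-assoc m (c ℕ.* m) k)) (trans (periodic _) (multiple-period c k))

balanced⇒zero : ¬ 4 ∣ suc n → (s : Fin (suc n) → ℤ) → Balanced s → ∀ i → s i ≡ 0ℤ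
balanced⇒zero {n} 4∤m s balanced i =
  trans (cong s (sym (toℕ-mod i))) (antiperiodic⇒zero (suc n) 4∤m t periodic antiperiodic (toℕ i))
  where
  t : ℕ → ℤ
  t k = s (k mod suc n)

  periodic : ∀ k → t (suc n ℕ.+ k) ≡ t k
  periodic k = cong s (mod-cong (suc n ℕ.+ k) k (%-remove-+ˡ k (∣-refl {suc n})))

  antiperiodic : ∀ k → t k + t (2 ℕ.+ k) ≡ 0ℤ
  antiperiodic k = subst₂ (λ a b → s a + s b ≡ 0ℤ)
    (prev-next (k mod suc n)) (trans (cong next (next-mod k)) (next-mod (suc k)))
    (balanced (next (k mod suc n)))

partner-unique : {V : Set} {ℓ : V → ℤ} (ρ : V → V) → Injective _≡_ _≡_ ℓ →
                 (∀ v → ℓ v + ℓ (ρ v) ≡ 0ℤ) → ∀ {u u′} → ℓ u + ℓ u′ ≡ 0ℤ → u′ ≡ ρ u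
partner-unique {ℓ = ℓ} ρ ℓ-injective partner {u} {u′} sum≡0 = ℓ-injective
  (trans (inverseʳ-unique (ℓ u) (ℓ u′) sum≡0) (sym (inverseʳ-unique (ℓ u) (ℓ (ρ u)) (partner u))))

selfReverse-via : {m : ℕ} {ℓ : Vertex m → ℤ} (ρ : Vertex m → Vertex m) → Injective _≡_ _≡_ ℓ →
                  (∀ v → ℓ v + ℓ (ρ v) ≡ 0ℤ) → (∀ u v → Adj m u v ⇔ Adj m (ρ u) (ρ v)) →
                  SelfReverse m ℓ
selfReverse-via ρ ℓ-injective partner ρ-automorphism u u′ v v′ uu′ vv′
  with refl ← partner-unique ρ ℓ-injective partner uu′
     | refl ← partner-unique ρ ℓ-injective partner vv′ = ρ-automorphism u v

twin : {m : ℕ} → Vertex m → Vertex m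
twin (b , i) = (not b , i)

columnSum≡0⇒selfReverse : {m : ℕ} (ℓ : Vertex m → ℤ) → Injective _≡_ _≡_ ℓ →
                          (∀ i → columnSum ℓ i ≡ 0ℤ) → SelfReverse m ℓ
columnSum≡0⇒selfReverse ℓ ℓ-injective columnSum≡0 =
  selfReverse-via twin ℓ-injective twin-partner (λ _ _ → mk⇔ id id)
  where
  twin-partner : ∀ v → ℓ v + ℓ (twin v) ≡ 0ℤ
  twin-partner (false , i) = columnSum≡0 i
  twin-partner (true  , i) = trans (ℤₚ.+-comm (ℓ (true , i)) (ℓ (false , i))) (columnSum≡0 i)

columnSum≡0⇒degenerate : (ℓ : Vertex (suc (suc n)) → ℤ) → (∀ i → columnSum ℓ i ≡ 0ℤ) →
                         Degenerate (suc (suc n)) ℓ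
columnSum≡0⇒degenerate ℓ columnSum≡0 =
  (false , 0F) , (true , 0F) , (false , 1F) , (true , 1F) ,
  columnSum≡0 0F , columnSum≡0 1F , (λ ()) , (λ ()) , inj₁ refl , inj₁ refl

¬4∣⇒selfReverse×degenerate : 3 ≤ suc (suc n) → ¬ 4 ∣ suc (suc n) → {ℓ : Vertex (suc (suc n)) → ℤ} →
                              IsDML (suc (suc n)) ℓ →
                              SelfReverse (suc (suc n)) ℓ × Degenerate (suc (suc n)) ℓ
¬4∣⇒selfReverse×degenerate 3≤m 4∤m {ℓ} dml@(_ , ℓ-injective , _) =
  columnSum≡0⇒selfReverse ℓ ℓ-injective columnSum≡0 , columnSum≡0⇒degenerate ℓ columnSum≡0
  where
  columnSum≡0 : ∀ i → columnSum ℓ i ≡ 0ℤ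
  columnSum≡0 = balanced⇒zero 4∤m (columnSum ℓ) (isDML⇒balanced 3≤m dml)

signed : Bool → ℤ → ℤ
signed true  z = z
signed false z = - z

signed-+-not : ∀ b z → signed b z + signed (not b) z ≡ 0ℤ
signed-+-not true  z = ℤₚ.+-inverseʳ z
signed-+-not false z = ℤₚ.+-inverseˡ z

signed-+ : ∀ b x y → signed b x + signed b y ≡ signed b (x + y)
signed-+ true  x y = refl
signed-+ false x y = sym (ℤₚ.neg-distrib-+ x y)

twinLabel : {m : ℕ} → Vertex m → ℤ
twinLabel (b , a) = signed b +[1+ 2 ℕ.* toℕ a ]

-- The position of the label of v in the increasing enumeration of 𝓘_{2m}.
index : {m : ℕ} → Vertex m → ℕ
index {m} (true  , a) = m ℕ.+ toℕ a
index     (false , a) = toℕ (opposite a)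

index-< : {m : ℕ} (v : Vertex m) → index v < 2 ℕ.* m
index-< {m} (true , a) =
  ℕₚ.+-monoʳ-< m (subst (toℕ a <_) (sym (ℕₚ.+-identityʳ m)) (Finₚ.toℕ<n a))
index-< {m} (false , a) = ℕₚ.<-≤-trans (Finₚ.toℕ<n (opposite a)) (ℕₚ.m≤m+n m (m ℕ.+ 0))

index-surjective : {m k : ℕ} → k < 2 ℕ.* m → ∃[ v ] index {m} v ≡ k
index-surjective {m} {k} k<2m with k ℕₚ.<? m
... | yes k<m = (false , opposite (fromℕ< k<m)) ,
  trans (cong toℕ (Finₚ.opposite-involutive _)) (Finₚ.toℕ-fromℕ< k<m)
... | no k≮m = (true , fromℕ< k∸m<m) ,
  trans (cong (m ℕ.+_) (Finₚ.toℕ-fromℕ< k∸m<m)) (ℕₚ.m+[n∸m]≡n m≤k)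
  where
  m≤k : m ≤ k
  m≤k = ℕₚ.≮⇒≥ k≮m

  k∸m<m : k ℕ.∸ m < m
  k∸m<m = subst (k ℕ.∸ m <_) (ℕₚ.m+n∸m≡n m m)
    (ℕₚ.∸-monoˡ-< (subst (k <_) (cong (m ℕ.+_) (ℕₚ.+-identityʳ m)) k<2m) m≤k)

twinLabel-index : {m : ℕ} (v : Vertex m) → twinLabel v ≡ (+ 1 - + (2 ℕ.* m)) + + (2 ℕ.* index v)
twinLabel-index {m} (true , a) = sym (begin
  (+ 1 - + (2 ℕ.* m)) + + (2 ℕ.* (m ℕ.+ toℕ a))
    ≡⟨ cong (λ x → (+ 1 - + (2 ℕ.* m)) + + x) (ℕₚ.*-distribˡ-+ 2 m (toℕ a)) ⟩
  (+ 1 - + (2 ℕ.* m)) + (+ (2 ℕ.* m) + + (2 ℕ.* toℕ a))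
    ≡⟨ cancel (+ (2 ℕ.* m)) (+ (2 ℕ.* toℕ a)) ⟩
  + 1 + + (2 ℕ.* toℕ a) ∎)
  where
  open ≡-Reasoning
  cancel : ∀ x y → (+ 1 + - x) + (x + y) ≡ + 1 + y
  cancel = ℤ-solve-∀
twinLabel-index {m} (false , a) = sym (begin
  (+ 1 - + (2 ℕ.* m)) + + (2 ℕ.* o)
    ≡⟨ cong (λ x → (+ 1 - + x) + + (2 ℕ.* o)) 2m≡2o+2+2a ⟩
  (+ 1 - (+ (2 ℕ.* o) + (+ 1 + +[1+ 2 ℕ.* toℕ a ]))) + + (2 ℕ.* o)
    ≡⟨ cancel (+ (2 ℕ.* o)) +[1+ 2 ℕ.* toℕ a ] ⟩
  -[1+ 2 ℕ.* toℕ a ] ∎)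
  where
  open ≡-Reasoning
  o : ℕ
  o = toℕ (opposite a)
  2m≡2o+2+2a : 2 ℕ.* m ≡ 2 ℕ.* o ℕ.+ suc (suc (2 ℕ.* toℕ a))
  2m≡2o+2+2a = trans (cong (2 ℕ.*_) (sym (toℕ-opposite-+ a))) (double o (toℕ a))
    where
    double : ∀ o a → 2 ℕ.* (o ℕ.+ suc a) ≡ 2 ℕ.* o ℕ.+ suc (suc (2 ℕ.* a))
    double = solve-∀
  cancel : ∀ x y → (+ 1 + - (x + (+ 1 + y))) + x ≡ - y
  cancel = ℤ-solve-∀

twinLabel-injective : {m : ℕ} → Injective _≡_ _≡_ (twinLabel {m})
twinLabel-injective {x = true , a} {true , b} eq =
  cong (true ,_) (Finₚ.toℕ-injective (ℕₚ.*-cancelˡ-≡ _ _ 2 (ℤₚ.+[1+-injective eq)))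
twinLabel-injective {x = false , a} {false , b} eq =
  cong (false ,_) (Finₚ.toℕ-injective (ℕₚ.*-cancelˡ-≡ _ _ 2 (ℤₚ.-[1+-injective eq)))

twinLabel-InI : {m : ℕ} (v : Vertex m) → InI (2 ℕ.* m) (twinLabel v)
twinLabel-InI v = index v , index-< v , twinLabel-index v

twinLabel-surjective : {m : ℕ} (z : ℤ) → InI (2 ℕ.* m) z → ∃[ v ] twinLabel {m} v ≡ z
twinLabel-surjective {m} z (k , k<2m , z≡) with index-surjective k<2m
... | v , index-v≡k = v , trans (twinLabel-index v)
  (trans (cong (λ k → (+ 1 - + (2 ℕ.* m)) + + (2 ℕ.* k)) index-v≡k) (sym z≡))

twinLabel-columnSum : {m : ℕ} (i : Fin m) → columnSum twinLabel i ≡ 0ℤ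
twinLabel-columnSum i = signed-+-not false +[1+ 2 ℕ.* toℕ i ]

twinLabel-isDML : 3 ≤ suc n → IsDML (suc n) twinLabel
twinLabel-isDML 3≤m = twinLabel-InI , twinLabel-injective , twinLabel-surjective ,
  balanced⇒neighbourSum≡0 3≤m
    (λ i → cong₂ _+_ (twinLabel-columnSum (prev i)) (twinLabel-columnSum (next i)))

twinLabel-selfReverse : {m : ℕ} → SelfReverse m twinLabel
twinLabel-selfReverse = columnSum≡0⇒selfReverse twinLabel twinLabel-injective twinLabel-columnSum

twinLabel-degenerate : Degenerate (suc (suc n)) twinLabel
twinLabel-degenerate = columnSum≡0⇒degenerate twinLabel twinLabel-columnSum

isDML-∘ : 3 ≤ suc n → {ℓ : Vertex (suc n) → ℤ} → IsDML (suc n) ℓ →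
          (φ : Vertex (suc n) → Vertex (suc n)) → Injective _≡_ _≡_ φ → StrictlySurjective _≡_ φ →
          Balanced (columnSum (ℓ ∘ φ)) → IsDML (suc n) (ℓ ∘ φ)
isDML-∘ {n} 3≤m {ℓ} (ℓ-InI , ℓ-injective , ℓ-surjective , _) φ φ-injective φ-surjective balanced =
  ℓ-InI ∘ φ , φ-injective ∘ ℓ-injective , surjective , balanced⇒neighbourSum≡0 3≤m balanced
  where
  surjective : ∀ z → InI (2 ℕ.* suc n) z → ∃[ v ] ℓ (φ v) ≡ z
  surjective z z∈𝓘 with ℓ-surjective z z∈𝓘
  ... | w , ℓw≡z with φ-surjective w
  ...   | v , φv≡w = v , trans (cong ℓ φv≡w) ℓw≡z

-- The reflected labeling

columnSign : ℕ → Bool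
columnSign 0 = true
columnSign 1 = true
columnSign 2 = false
columnSign 3 = false
columnSign (suc (suc (suc (suc k)))) = columnSign k

columnSign-2+ : ∀ k → columnSign (2 ℕ.+ k) ≡ not (columnSign k)
columnSign-2+ 0 = refl
columnSign-2+ 1 = refl
columnSign-2+ 2 = refl
columnSign-2+ 3 = refl
columnSign-2+ (suc (suc (suc (suc k)))) = columnSign-2+ k

columnSign-periodic : ∀ q k → columnSign (q ℕ.* 4 ℕ.+ k) ≡ columnSign k
columnSign-periodic zero    k = refl
columnSign-periodic (suc q) k = columnSign-periodic q k

columnSign-% : 4 ∣ suc n → ∀ k → columnSign (k % suc n) ≡ columnSign k
columnSign-% {n} (divides q m≡q*4) k = sym (begin
  columnSign k                              ≡⟨ cong columnSign (m≡m%n+[m/n]*n k (suc n)) ⟩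
  columnSign (k % suc n ℕ.+ d ℕ.* suc n)    ≡⟨ cong columnSign (ℕₚ.+-comm (k % suc n) _) ⟩
  columnSign (d ℕ.* suc n ℕ.+ k % suc n)    ≡⟨ cong (λ x → columnSign (x ℕ.+ k % suc n)) multiple ⟩
  columnSign (d ℕ.* q ℕ.* 4 ℕ.+ k % suc n)  ≡⟨ columnSign-periodic (d ℕ.* q) _ ⟩
  columnSign (k % suc n)                    ∎)
  where
  open ≡-Reasoning
  d : ℕ
  d = k ℕ./ suc n
  multiple : d ℕ.* suc n ≡ d ℕ.* q ℕ.* 4
  multiple = trans (cong (d ℕ.*_) m≡q*4) (sym (ℕₚ.*-assoc d q 4))

columnSign-reflect : ∀ a b q → a ℕ.+ suc b ≡ q ℕ.* 4 → columnSign a ≡ not (columnSign b)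
columnSign-reflect a 0 (suc q) a+1≡4+4q =
  trans (cong columnSign (ℕₚ.+-cancelʳ-≡ 1 a (q ℕ.* 4 ℕ.+ 3) (trans a+1≡4+4q (split q))))
        (columnSign-periodic q 3)
  where
  split : ∀ q → suc q ℕ.* 4 ≡ q ℕ.* 4 ℕ.+ 3 ℕ.+ 1
  split = solve-∀
columnSign-reflect a 1 (suc q) a+2≡4+4q =
  trans (cong columnSign (ℕₚ.+-cancelʳ-≡ 2 a (q ℕ.* 4 ℕ.+ 2) (trans a+2≡4+4q (split q))))
        (columnSign-periodic q 2)
  where
  split : ∀ q → suc q ℕ.* 4 ≡ q ℕ.* 4 ℕ.+ 2 ℕ.+ 2
  split = solve-∀
columnSign-reflect a (suc (suc b)) q a+3+b≡4q = begin
  columnSign a                    ≡⟨ Boolₚ.not-involutive _ ⟨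
  not (not (columnSign a))        ≡⟨ cong not (columnSign-2+ a) ⟨
  not (columnSign (2 ℕ.+ a))
    ≡⟨ cong not (columnSign-reflect (2 ℕ.+ a) b q (trans (shift a b) a+3+b≡4q)) ⟩
  not (not (columnSign b))        ≡⟨ cong not (columnSign-2+ b) ⟨
  not (columnSign (2 ℕ.+ b))      ∎
  where
  open ≡-Reasoning
  shift : ∀ a b → 2 ℕ.+ a ℕ.+ suc b ≡ a ℕ.+ suc (suc (suc b))
  shift = solve-∀
columnSign-reflect a 0 0 a+1≡0 = contradiction (trans (sym (ℕₚ.+-suc a 0)) a+1≡0) λ ()
columnSign-reflect a 1 0 a+2≡0 = contradiction (trans (sym (ℕₚ.+-suc a 1)) a+2≡0) λ ()

columnSign-opposite : 4 ∣ suc n → (i : Fin (suc n)) →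
                      columnSign (toℕ (opposite i)) ≡ not (columnSign (toℕ i))
columnSign-opposite (divides q m≡q*4) i =
  columnSign-reflect _ _ q (trans (toℕ-opposite-+ i) m≡q*4)

columnSign-next : 4 ∣ suc n → (i : Fin (suc n)) →
                  columnSign (toℕ (next i)) ≡ not (columnSign (toℕ (prev i)))
columnSign-next {n} 4∣m i = begin
  columnSign (toℕ (next i))                  ≡⟨ cong columnSign toℕ-next≡2+prev ⟩
  columnSign ((2 ℕ.+ toℕ (prev i)) % suc n)  ≡⟨ columnSign-% 4∣m (2 ℕ.+ toℕ (prev i)) ⟩
  columnSign (2 ℕ.+ toℕ (prev i))            ≡⟨ columnSign-2+ (toℕ (prev i)) ⟩
  not (columnSign (toℕ (prev i)))            ∎
  where
  open ≡-Reasoning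
  p : ℕ
  p = toℕ (prev i)
  toℕ-next≡2+prev : toℕ (next i) ≡ (2 ℕ.+ p) % suc n
  toℕ-next≡2+prev = begin
    toℕ (next i)                   ≡⟨ cong (toℕ ∘ next) (next-prev i) ⟨
    toℕ (next (next (prev i)))     ≡⟨ toℕ-next (next (prev i)) ⟩
    suc (toℕ (next (prev i))) % suc n ≡⟨ cong (λ x → suc x % suc n) (toℕ-next (prev i)) ⟩
    suc (suc p % suc n) % suc n    ≡⟨ suc-%-% {n} (suc p) ⟩
    suc (suc p) % suc n            ∎

module Reflected {n : ℕ} (4∣m : 4 ∣ suc n) where

  m : ℕ
  m = suc n

  σ : Fin m → Bool
  σ i = columnSign (toℕ i)

  reflect : Vertex m → Vertex m
  reflect (false , i) = (σ i , i)
  reflect (true  , i) = (σ i , opposite i)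

  reflect-injective : Injective _≡_ _≡_ reflect
  reflect-injective {false , i} {false , j} eq = cong (false ,_) (cong proj₂ eq)
  reflect-injective {true , i} {true , j} eq =
    cong (true ,_) (retraction⇒injective opposite Finₚ.opposite-involutive (cong proj₂ eq))
  reflect-injective {false , i} {true , j} eq = contradiction
    (trans (sym (cong proj₁ eq)) (trans (cong σ (cong proj₂ eq)) (columnSign-opposite 4∣m j)))
    (Boolₚ.not-¬ refl)
  reflect-injective {true , i} {false , j} eq = contradiction
    (trans (cong proj₁ eq) (trans (cong σ (sym (cong proj₂ eq))) (columnSign-opposite 4∣m i)))
    (Boolₚ.not-¬ refl)

  reflect-surjective : StrictlySurjective _≡_ reflect
  reflect-surjective (s , a) with s Boolₚ.≟ σ a
  ... | yes s≡σa = (false , a) , cong (_, a) (sym s≡σa)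
  ... | no  s≢σa = (true , opposite a) , cong₂ _,_
    (trans (columnSign-opposite 4∣m a) (sym (Boolₚ.¬-not s≢σa))) (Finₚ.opposite-involutive a)

  3≤m : 3 ≤ m
  3≤m = ℕₚ.<⇒≤ (∣⇒≤ 4∣m)

  reflectedLabel : Vertex m → ℤ
  reflectedLabel = twinLabel ∘ reflect

  reflectedLabel-injective : Injective _≡_ _≡_ reflectedLabel
  reflectedLabel-injective = reflect-injective ∘ twinLabel-injective

  reflectedLabel-columnSum : ∀ i → columnSum reflectedLabel i ≡ signed (σ i) (+ (2 ℕ.* m))
  reflectedLabel-columnSum i = trans (signed-+ (σ i) _ _) (cong (signed (σ i) ∘ +_) (begin
    suc (2 ℕ.* toℕ i) ℕ.+ suc (2 ℕ.* toℕ (opposite i))  ≡⟨ double (toℕ i) (toℕ (opposite i)) ⟩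
    2 ℕ.* (toℕ (opposite i) ℕ.+ suc (toℕ i))            ≡⟨ cong (2 ℕ.*_) (toℕ-opposite-+ i) ⟩
    2 ℕ.* m                                             ∎))
    where
    open ≡-Reasoning
    double : ∀ a b → suc (2 ℕ.* a) ℕ.+ suc (2 ℕ.* b) ≡ 2 ℕ.* (b ℕ.+ suc a)
    double = solve-∀

  reflectedLabel-balanced : Balanced (columnSum reflectedLabel)
  reflectedLabel-balanced i = begin
    columnSum reflectedLabel (prev i) + columnSum reflectedLabel (next i)
      ≡⟨ cong₂ _+_ (reflectedLabel-columnSum (prev i)) (reflectedLabel-columnSum (next i)) ⟩
    signed (σ (prev i)) K + signed (σ (next i)) K
      ≡⟨ cong (λ b → signed (σ (prev i)) K + signed b K) (columnSign-next 4∣m i) ⟩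
    signed (σ (prev i)) K + signed (not (σ (prev i))) K
      ≡⟨ signed-+-not (σ (prev i)) K ⟩
    0ℤ ∎
    where
    open ≡-Reasoning
    K : ℤ
    K = + (2 ℕ.* m)

  reflectedLabel-isDML : IsDML m reflectedLabel
  reflectedLabel-isDML = isDML-∘ 3≤m (twinLabel-isDML 3≤m) reflect reflect-injective reflect-surjective
    reflectedLabel-balanced

  antipode : Vertex m → Vertex m
  antipode (b , i) = (not b , opposite i)

  reflectedLabel-antipode : ∀ v → reflectedLabel v + reflectedLabel (antipode v) ≡ 0ℤ
  reflectedLabel-antipode (false , i)
    rewrite columnSign-opposite 4∣m i | Finₚ.opposite-involutive i = signed-+-not (σ i) _
  reflectedLabel-antipode (true , i)
    rewrite columnSign-opposite 4∣m i = signed-+-not (σ i) _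

  reflectedLabel-selfReverse : SelfReverse m reflectedLabel
  reflectedLabel-selfReverse = selfReverse-via antipode reflectedLabel-injective reflectedLabel-antipode
    (λ _ _ → mk⇔ cycAdj-opposite opposite-cycAdj)

  -- Since m is even, the two neighbours of a column have equal parity, while j and m − 1 − j do not.
  reflectedLabel-nonDegenerate : ¬ Degenerate m reflectedLabel
  reflectedLabel-nonDegenerate ((_ , k) , _ , v@(_ , j) , v′ , _ , vv′ , _ , _ , k~j , k~j′)
    with refl ← partner-unique antipode reflectedLabel-injective reflectedLabel-antipode {v} {v′} vv′ =
    Parityₚ.p≢p⁻¹ (parity (toℕ j)) (begin
      parity (toℕ j)             ≡⟨ cycAdj-parity even k~j ⟩
      parity (toℕ k) ⁻¹          ≡⟨ cycAdj-parity even k~j′ ⟨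
      parity (toℕ (opposite j))  ≡⟨ opposite-parity even j ⟩
      parity (toℕ j) ⁻¹          ∎)
    where
    open ≡-Reasoning
    even : parity m ≡ 0ℙ
    even = 4∣⇒even 4∣m

-- A labeling that is not self-reverse

swap04 : {k : ℕ} → Fin (8 ℕ.+ k) → Fin (8 ℕ.+ k)
swap04 0F = 4F
swap04 4F = 0F
swap04 i  = i

swap04-involutive : {k : ℕ} (i : Fin (8 ℕ.+ k)) → swap04 (swap04 i) ≡ i
swap04-involutive 0F = refl
swap04-involutive 1F = refl
swap04-involutive 2F = refl
swap04-involutive 3F = refl
swap04-involutive 4F = refl
swap04-involutive (Fin.suc (Fin.suc (Fin.suc (Fin.suc (Fin.suc _))))) = refl

columnSign-swap04 : {k : ℕ} (i : Fin (8 ℕ.+ k)) → columnSign (toℕ (swap04 i)) ≡ columnSign (toℕ i)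
columnSign-swap04 0F = refl
columnSign-swap04 1F = refl
columnSign-swap04 2F = refl
columnSign-swap04 3F = refl
columnSign-swap04 4F = refl
columnSign-swap04 (Fin.suc (Fin.suc (Fin.suc (Fin.suc (Fin.suc _))))) = refl

-- Fails for m = 9, where column m − 5 is column 4 itself.
swap04-opposite-4 : {k : ℕ} → 4 ∣ 8 ℕ.+ k → swap04 (opposite 4F) ≡ opposite {8 ℕ.+ k} 4F
swap04-opposite-4 {0}               _   = refl
swap04-opposite-4 {1}               4∣9 = contradiction 4∣9 (from-no (4 ∣? 9))
swap04-opposite-4 {suc (suc _)}     _   = refl

¬cycAdj-4-1 : {k : ℕ} → ¬ CycAdj (8 ℕ.+ k) 4F 1F
¬cycAdj-4-1 (inj₁ ())
¬cycAdj-4-1 (inj₂ (inj₁ ()))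
¬cycAdj-4-1 (inj₂ (inj₂ (inj₁ (() , _))))
¬cycAdj-4-1 (inj₂ (inj₂ (inj₂ (() , _))))

module Swapped {k : ℕ} (4∣m : 4 ∣ 8 ℕ.+ k) where

  open Reflected 4∣m

  swappedLabel : Vertex m → ℤ
  swappedLabel = reflectedLabel ∘ map₂ swap04

  swappedLabel-isDML : IsDML m swappedLabel
  swappedLabel-isDML = isDML-∘ 3≤m reflectedLabel-isDML (map₂ swap04)
    (retraction⇒injective (map₂ swap04) (λ (b , i) → cong (b ,_) (swap04-involutive i)))
    (λ (b , i) → (b , swap04 i) , cong (b ,_) (swap04-involutive i))
    (λ i → subst₂ (λ x y → x + y ≡ 0ℤ) (same-columnSum (prev i)) (same-columnSum (next i))
      (reflectedLabel-balanced i))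
    where
    same-columnSum : ∀ i → columnSum reflectedLabel i ≡ columnSum swappedLabel i
    same-columnSum i = begin
      columnSum reflectedLabel i           ≡⟨ reflectedLabel-columnSum i ⟩
      signed (σ i) K                       ≡⟨ cong (λ b → signed b K) (columnSign-swap04 i) ⟨
      signed (σ (swap04 i)) K              ≡⟨ reflectedLabel-columnSum (swap04 i) ⟨
      columnSum reflectedLabel (swap04 i)  ∎
      where
      open ≡-Reasoning
      K : ℤ
      K = + (2 ℕ.* m)

  -- x₀ ~ x₁, but their reverses y_{m−5} and y_{m−2} are not adjacent.
  swappedLabel-not-selfReverse : ¬ SelfReverse m swappedLabel
  swappedLabel-not-selfReverse selfReverse = ¬cycAdj-4-1 (opposite-cycAdj
    (Equivalence.to (selfReverse (false , 0F) (true , opposite 4F) (false , 1F) (true , opposite 1F)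
      x₀-reverse x₁-reverse) (inj₁ refl)))
    where
    x₀-reverse : swappedLabel (false , 0F) + swappedLabel (true , opposite 4F) ≡ 0ℤ
    x₀-reverse rewrite swap04-opposite-4 4∣m = reflectedLabel-antipode (false , 4F)

    x₁-reverse : swappedLabel (false , 1F) + swappedLabel (true , opposite 1F) ≡ 0ℤ
    x₁-reverse = reflectedLabel-antipode (false , 1F)

nonSelfReverseDML : {m : ℕ} → 8 ≤ m → 4 ∣ m → ∃[ ℓ ] (IsDML m ℓ × ¬ SelfReverse m ℓ)
nonSelfReverseDML 8≤m 4∣m with ℕₚ.m≤n⇒∃[o]m+o≡n 8≤m
... | _ , refl = swappedLabel , swappedLabel-isDML , swappedLabel-not-selfReverse
  where open Swapped 4∣m

proposition4p2 : (m : ℕ) → 3 ≤ m →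
    ((¬ (4 ∣ m)) → (ℓ : Vertex m → ℤ) → IsDML m ℓ →
        SelfReverse m ℓ × Degenerate m ℓ)
    × (4 ∣ m →
        (∃[ ℓ ] (IsDML m ℓ × SelfReverse m ℓ × Degenerate m ℓ))
        × (∃[ ℓ ] (IsDML m ℓ × SelfReverse m ℓ × ¬ Degenerate m ℓ))
        × (8 ≤ m → ∃[ ℓ ] (IsDML m ℓ × ¬ SelfReverse m ℓ)))
proposition4p2 1 (s≤s ())
proposition4p2 (suc (suc n)) 3≤m =
  (λ 4∤m _ → ¬4∣⇒selfReverse×degenerate 3≤m 4∤m) , λ 4∣m →
    (twinLabel , twinLabel-isDML 3≤m , twinLabel-selfReverse , twinLabel-degenerate) ,
    (let open Reflected 4∣m in
      reflectedLabel , reflectedLabel-isDML , reflectedLabel-selfReverse ,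
      reflectedLabel-nonDegenerate) ,
    (λ 8≤m → nonSelfReverseDML 8≤m 4∣m)
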